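{- Every AL-monoid $A$ is ptolemaic (with $\wedge$ as multiplication): for all $a,b,c,d\in A$, $$(a\ast b)\wedge(c\ast d)\leq (a\ast c)\wedge(b\ast d)+(a\ast d)\wedge(b\ast c),$$ $$(a\ast c)\wedge(b\ast d)\leq (a\ast b)\wedge(c\ast d)+(a\ast d)\wedge(c\ast b),$$ $$(a\ast d)\wedge(b\ast c)\leq (a\ast c)\wedge(d\ast b)+(a\ast b)\wedge(c\ast d).$$
   Context: An AL-monoid (autometrized lattice ordered monoid) is an algebra $(A,+,\vee,\wedge,\ast,0)$ of type $(2,2,2,2,0)$ such that: (1) $(A,+,\vee,\wedge,0)$ is a commutative lattice ordered monoid, i.e. $(A,+,0)$ is a commutative monoid with identity $0$, $(A,\vee,\wedge)$ is a lattice with induced order $\leq$, and $a+(b\vee c)=(a+b)\vee(a+c)$, $a+(b\wedge c)=(a+b)\wedge(a+c)$; (2) $a\ast(a\wedge b)+b=a\vee b$ for all $a,b$; (3) for each $a\in A$ the maps $x\mapsto a+x$, $x\mapsto a\vee x$, $x\mapsto a\wedge x$, $x\mapsto a\ast x$ are contractions with respect to $\ast$, i.e. $f(x)\ast f(y)\leq x\ast y$ for all $x,y$; (4) $[a\ast(a\vee b)]\wedge[b\ast(a\vee b)]=0$ for all $a,b$; and $\ast$ is a metric operation: $a\ast b\geq 0$ with equality iff $a=b$, $a\ast b=b\ast a$, and $a\ast b\leq a\ast c+c\ast b$ for all $a,b,c$. -}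

module Defs where

open import Level using (Level; suc; _⊔_)
open import Relation.Binary.PropositionalEquality using (_≡_)
open import Algebra.Structures using (IsCommutativeMonoid)
open import Algebra.Lattice.Structures using (IsLattice)

record ALMonoid (c : Level) : Set (suc c) where
  infixl 6 _+_
  infixr 7 _∨_
  infixr 8 _∧_
  infixl 9 _⋆_
  infix 4 _≤_
  field
    Carrier : Set c
    _+_ _∨_ _∧_ _⋆_ : Carrier → Carrier → Carrier
    0# : Carrier

  _≤_ : Carrier → Carrier → Set c
  a ≤ b = a ∧ b ≡ a

  field
    +-isCommutativeMonoid : IsCommutativeMonoid _≡_ _+_ 0#
    isLattice : IsLattice _≡_ _∨_ _∧_
    +-distrib-∨ : ∀ a b c → a + (b ∨ c) ≡ (a + b) ∨ (a + c)
    +-distrib-∧ : ∀ a b c → a + (b ∧ c) ≡ (a + b) ∧ (a + c)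
    ⋆-∧-+ : ∀ a b → a ⋆ (a ∧ b) + b ≡ a ∨ b
    +-contr : ∀ a x y → (a + x) ⋆ (a + y) ≤ x ⋆ y
    ∨-contr : ∀ a x y → (a ∨ x) ⋆ (a ∨ y) ≤ x ⋆ y
    ∧-contr : ∀ a x y → (a ∧ x) ⋆ (a ∧ y) ≤ x ⋆ y
    ⋆-contr : ∀ a x y → (a ⋆ x) ⋆ (a ⋆ y) ≤ x ⋆ y
    ⋆-∨-meet : ∀ a b → (a ⋆ (a ∨ b)) ∧ (b ⋆ (a ∨ b)) ≡ 0#
    ⋆-nonneg : ∀ a b → 0# ≤ a ⋆ b
    ⋆-zero⇒≡ : ∀ a b → a ⋆ b ≡ 0# → a ≡ b
    ⋆-self : ∀ a → a ⋆ a ≡ 0#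
    ⋆-comm : ∀ a b → a ⋆ b ≡ b ⋆ a
    ⋆-triangle : ∀ a b c → a ⋆ b ≤ a ⋆ c + c ⋆ b

module Submission where

open import Defs
open import Data.Product using (_×_; _,_)
open import Relation.Binary.PropositionalEquality
open import Algebra.Structures using (IsCommutativeMonoid)
open import Algebra.Lattice.Bundles using (Lattice)
import Algebra.Lattice.Properties.Lattice as LatticeProperties
import Relation.Binary.Lattice.Bundles as OrderLattice

module ALMonoidProperties {ℓ} (A : ALMonoid ℓ) where
  open ALMonoid A
  open IsCommutativeMonoid +-isCommutativeMonoid using () renaming (comm to +-comm)

  lattice : Lattice ℓ ℓ
  lattice = record { isLattice = isLattice }

  -- The standard library's meet order is  x ≡ x ∧ y,  the symmetric form of  _≤_.
  private
    module Meet = OrderLattice.MeetSemilattice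
      (LatticeProperties.∧-orderTheoreticMeetSemilattice lattice)

  x∧y≤x : ∀ x y → x ∧ y ≤ x
  x∧y≤x x y = sym (Meet.x∧y≤x x y)

  x∧y≤y : ∀ x y → x ∧ y ≤ y
  x∧y≤y x y = sym (Meet.x∧y≤y x y)

  ∧-greatest : ∀ {x y z} → x ≤ y → x ≤ z → x ≤ y ∧ z
  ∧-greatest p q = sym (Meet.∧-greatest (sym p) (sym q))

  ≤-trans : ∀ {x y z} → x ≤ y → y ≤ z → x ≤ z
  ≤-trans p q = sym (Meet.trans (sym p) (sym q))

  ≤-respʳ-≡ : ∀ {x y z} → x ≤ y → y ≡ z → x ≤ z
  ≤-respʳ-≡ p refl = p

  +-distrib-∧ʳ : ∀ a b c → (b ∧ c) + a ≡ (b + a) ∧ (c + a)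
  +-distrib-∧ʳ a b c = begin
    (b ∧ c) + a        ≡⟨ +-comm (b ∧ c) a ⟩
    a + (b ∧ c)        ≡⟨ +-distrib-∧ a b c ⟩
    (a + b) ∧ (a + c)  ≡⟨ cong₂ _∧_ (+-comm a b) (+-comm a c) ⟩
    (b + a) ∧ (c + a)  ∎
    where open ≡-Reasoning

  ∧-+-∧-expand : ∀ x y u v →
    (x ∧ y) + (u ∧ v) ≡ ((x + u) ∧ (y + u)) ∧ ((x + v) ∧ (y + v))
  ∧-+-∧-expand x y u v = begin
    (x ∧ y) + (u ∧ v)                        ≡⟨ +-distrib-∧ (x ∧ y) u v ⟩
    ((x ∧ y) + u) ∧ ((x ∧ y) + v)            ≡⟨ cong₂ _∧_ (+-distrib-∧ʳ u x y) (+-distrib-∧ʳ v x y) ⟩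
    ((x + u) ∧ (y + u)) ∧ ((x + v) ∧ (y + v)) ∎
    where open ≡-Reasoning

  ≤-∧-+-∧ : ∀ {r x y u v} → r ≤ x + u → r ≤ y + u → r ≤ x + v → r ≤ y + v →
    r ≤ (x ∧ y) + (u ∧ v)
  ≤-∧-+-∧ {x = x} {y} {u} {v} p q s t =
    ≤-respʳ-≡ (∧-greatest (∧-greatest p q) (∧-greatest s t)) (sym (∧-+-∧-expand x y u v))

  -- Each of the four sums (a ⋆ c or b ⋆ d) + (a ⋆ d or b ⋆ c) is a path from a to b or from
  -- c to d through the remaining point, so the triangle inequality bounds it below by a ⋆ b
  -- or by c ⋆ d, and hence by their meet.
  ptolemy : ∀ a b c d → (a ⋆ b) ∧ (c ⋆ d) ≤ (a ⋆ c) ∧ (b ⋆ d) + (a ⋆ d) ∧ (b ⋆ c)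
  ptolemy a b c d = ≤-∧-+-∧
    (≤-trans (x∧y≤y _ _) (≤-respʳ-≡ (⋆-triangle c d a)
      (cong (_+ a ⋆ d) (⋆-comm c a))))
    (≤-trans (x∧y≤x _ _) (≤-respʳ-≡ (⋆-triangle a b d)
      (trans (+-comm (a ⋆ d) (d ⋆ b)) (cong (_+ a ⋆ d) (⋆-comm d b)))))
    (≤-trans (x∧y≤x _ _) (≤-respʳ-≡ (⋆-triangle a b c)
      (cong (a ⋆ c +_) (⋆-comm c b))))
    (≤-trans (x∧y≤y _ _) (≤-respʳ-≡ (⋆-triangle c d b)
      (trans (+-comm (c ⋆ b) (b ⋆ d)) (cong (b ⋆ d +_) (⋆-comm c b)))))

mainTheorem12 : ∀ {ℓ} (A : ALMonoid ℓ) → let open ALMonoid A in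
    ∀ a b c d →
      ((a ⋆ b) ∧ (c ⋆ d) ≤ (a ⋆ c) ∧ (b ⋆ d) + (a ⋆ d) ∧ (b ⋆ c))
      × ((a ⋆ c) ∧ (b ⋆ d) ≤ (a ⋆ b) ∧ (c ⋆ d) + (a ⋆ d) ∧ (c ⋆ b))
      × ((a ⋆ d) ∧ (b ⋆ c) ≤ (a ⋆ c) ∧ (d ⋆ b) + (a ⋆ b) ∧ (c ⋆ d))
mainTheorem12 A a b c d =
  ptolemy a b c d ,
  ptolemy a c b d ,
  ≤-respʳ-≡ (ptolemy a d b c)
    (trans (+-comm ((a ⋆ b) ∧ (d ⋆ c)) ((a ⋆ c) ∧ (d ⋆ b)))
           (cong (λ w → (a ⋆ c) ∧ (d ⋆ b) + (a ⋆ b) ∧ w) (⋆-comm d c)))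
  where
  open ALMonoid A
  open ALMonoidProperties A
  open IsCommutativeMonoid +-isCommutativeMonoid using () renaming (comm to +-comm)
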